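{- Let $p\neq q$ be primes, let $\mathbf P$ be a finite abelian $p$-group and $\mathbf Q$ a finite abelian $q$-group, and let $\mathbf G=\mathbf P\times\mathbf Q$. Let $a\in P$ and $b\in Q$ with $a\neq e$, $b\neq e$, $a\notin M(\mathbf P)$, $o(b)=q^u$ and $b\in M(\mathbf Q)$. Then the neighborhood class of $(a,b)$ in $\mathcal D(\mathbf G)$ is $[(a,b)]=\{(x,y)\in P\times Q : \langle x\rangle=\langle a\rangle,\ o(y)=q^u,\ |\langle b\rangle\cap\langle y\rangle|\geq q^{u-1},\ y\in M(\mathbf Q)\}$.
   Context: $e$ denotes the identity element and $o(x)$ the order of $x$. For a finite group $\mathbf K$, $M(\mathbf K)$ is the set of all generators of maximal cyclic subgroups of $\mathbf K$. The power graph of a group $\mathbf K$ is the simple graph on $K$ in which two distinct elements are adjacent iff one is a power of the other; the enhanced power graph of $\mathbf K$ is the simple graph on $K$ in which two distinct elements are adjacent iff they generate a cyclic subgroup. The difference graph $\mathcal D(\mathbf K)$ is the graph whose edges are the pairs adjacent in the enhanced power graph but not in the power graph, with all isolated vertices removed. For a vertex $v$ of a graph, its neighborhood class $[v]$ is the set of all vertices having the same neighborhood as $v$. -}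

module Defs where

open import Level using (Level; _⊔_)
open import Algebra.Bundles using (Group; AbelianGroup)
open import Data.Nat using (ℕ; zero; suc; _<_; _≤_; _^_)
open import Data.Fin using (Fin)
open import Data.Product using (Σ; ∃; _×_; _,_)
open import Relation.Nullary using (¬_)
open import Relation.Binary.PropositionalEquality using (_≡_)
open import Function.Bundles using (_⇔_)

module GroupNotions {c ℓ : Level} (K : Group c ℓ) where
  open Group K

  pow : Carrier → ℕ → Carrier
  pow x zero    = ε
  pow x (suc n) = x ∙ pow x n

  -- membership in the cyclic subgroup ⟨ x ⟩  (K finite, so ℕ-powers suffice)
  _∈⟨_⟩ : Carrier → Carrier → Set ℓ
  y ∈⟨ x ⟩ = ∃ λ n → y ≈ pow x n

  SameCyclic : Carrier → Carrier → Set ℓ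
  SameCyclic x y = (x ∈⟨ y ⟩) × (y ∈⟨ x ⟩)

  HasOrder : Carrier → ℕ → Set ℓ
  HasOrder x n = (0 < n) × (pow x n ≈ ε) × (∀ m → 0 < m → m < n → ¬ (pow x m ≈ ε))

  IsFinite : Set (c ⊔ ℓ)
  IsFinite = ∃ λ n → Σ (Fin n → Carrier) λ f → ∀ x → ∃ λ i → x ≈ f i

  IsPGroup : ℕ → Set (c ⊔ ℓ)
  IsPGroup p = ∀ x → ∃ λ k → HasOrder x (p ^ k)

  -- x ∈ M(K): x generates a maximal cyclic subgroup, i.e.
  -- ⟨ x ⟩ ⊆ ⟨ y ⟩ implies ⟨ y ⟩ ⊆ ⟨ x ⟩ (equivalently y ∈ ⟨ x ⟩)
  InM : Carrier → Set (c ⊔ ℓ)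
  InM x = ∀ y → x ∈⟨ y ⟩ → y ∈⟨ x ⟩

  CardGE : (Carrier → Set ℓ) → ℕ → Set (c ⊔ ℓ)
  CardGE S k = Σ (Fin k → Carrier) λ f →
    (∀ i → S (f i)) × (∀ i j → f i ≈ f j → i ≡ j)

  PowAdj : Carrier → Carrier → Set ℓ
  PowAdj x y = ¬ (x ≈ y) × ((y ∈⟨ x ⟩) Data.Sum.⊎ (x ∈⟨ y ⟩))
    where import Data.Sum

  -- enhanced power graph adjacency: distinct and ⟨ x , y ⟩ is cyclic,
  -- i.e. x and y lie in a common cyclic subgroup
  EnhAdj : Carrier → Carrier → Set (c ⊔ ℓ)
  EnhAdj x y = ¬ (x ≈ y) × (∃ λ z → (x ∈⟨ z ⟩) × (y ∈⟨ z ⟩))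

  DAdj : Carrier → Carrier → Set (c ⊔ ℓ)
  DAdj x y = EnhAdj x y × ¬ PowAdj x y

  DVertex : Carrier → Set (c ⊔ ℓ)
  DVertex x = ∃ λ y → DAdj x y

  InNbhdClass : Carrier → Carrier → Set (c ⊔ ℓ)
  InNbhdClass v w = DVertex w × (∀ z → DAdj w z ⇔ DAdj v z)

-- In a cyclic r-group the cyclic subgroups form a chain, and the proper ones inside ⟨w⟩ are exactly
-- those inside ⟨w ^ r⟩. Since p ≠ q, ⟨(x , y)⟩ = ⟨x⟩ × ⟨y⟩ in P × Q, so (x , y) and (x' , y') are
-- adjacent in 𝒟(P × Q) exactly when ⟨x⟩ ⊊ ⟨x'⟩ and ⟨y'⟩ ⊊ ⟨y⟩, or the other way round. As b ∈ M(Q),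
-- the neighbours of (a , b) are the (x' , y') with ⟨a⟩ ⊊ ⟨x'⟩ and ⟨y'⟩ ⊊ ⟨b⟩, and a ∉ M(P) provides
-- some ⟨a⟩ ⊊ ⟨a'⟩. Comparing neighbourhoods on test vertices built from a', e, a, x and the y' forces
-- ⟨x⟩ = ⟨a⟩, y ∈ M(Q), and that ⟨y⟩ and ⟨b⟩ have the same proper subgroups, i.e. ⟨y ^ q⟩ = ⟨b ^ q⟩.
-- For y of order q ^ u this last condition is equivalent to |⟨b⟩ ∩ ⟨y⟩| ≥ q ^ (u - 1).

{-# OPTIONS --safe #-}
module Submission where

open import Defs
open import Level using (Level; _⊔_)
open import Algebra.Bundles using (AbelianGroup; Group)
open import Algebra.Construct.DirectProduct using (abelianGroup; group)
open import Data.Nat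
  using (ℕ; zero; suc; _+_; _*_; _^_; _∸_; _<_; z≤n; s≤s; NonZero; >-nonZero; nonTrivial⇒n>1)
open import Data.Nat.Properties
  using (<-irrefl; +-identityʳ; +-comm; m*n≢0⇒m≢0; *-comm; ≮⇒≥; n≤0⇒n≡0; <⇒≱; ^-monoʳ-<;
        m^n≢0; n<1+n; <-cmp; m<n⇒0<n∸m; m∸n≤m; ≤-<-trans; m+[n∸m]≡n; <⇒≤; *-monoʳ-<; 1+n≢0;
        *-zeroʳ)
open import Data.Nat.Divisibility using (_∣_; divides; _∣?_; ∣-trans; ∣1⇒≡1; ∣-antisym; ∣⇒≤; m%n≡0⇒n∣m)
open import Data.Nat.DivMod using (_%_; _/_; m%n<n; m≡m%n+[m/n]*n)
open import Data.Nat.Primality using (Prime; prime⇒irreducible; prime⇒nonTrivial)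
open import Data.Nat.Coprimality using (Coprime; coprime-divisor; coprime-Bézout)
import Data.Nat.Coprimality as Coprimality
open import Data.Nat.GCD using (module Bézout)
open import Data.Nat.Tactic.RingSolver using (solve)
open import Data.List using ([]; _∷_)
open import Data.Fin using (Fin; toℕ; fromℕ<)
open import Data.Fin.Properties using (toℕ-fromℕ<; toℕ-injective; toℕ<n; pigeonhole; any?)
import Data.Fin.Properties as Fin
open import Data.Product using (_×_; _,_; proj₁; proj₂; Σ; ∃; swap)
import Data.Product as Product
open import Data.Sum using (_⊎_; inj₁; inj₂; fromInj₁; fromInj₂)
import Data.Sum as Sum
open import Data.Empty using (⊥-elim)
open import Relation.Nullary using (¬_; Dec; yes; no; contradiction)
open import Relation.Nullary.Decidable using (_×-dec_; ¬?; map′)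
open import Relation.Binary.Definitions using (tri<; tri≈; tri>)
open import Relation.Binary.PropositionalEquality as ≡ using (_≡_; _≢_)
open import Function.Base using (_∘_; id)
open import Function.Bundles using (_⇔_; mk⇔; Equivalence)

open Equivalence using (to; from)

prime⇒1< : ∀ {p} → Prime p → 1 < p
prime⇒1< {p} pp = nonTrivial⇒n>1 p {{prime⇒nonTrivial pp}}

prime∤⇒coprime : ∀ {q m} → Prime q → ¬ q ∣ m → Coprime m q
prime∤⇒coprime pq q∤m (d∣m , d∣q) with prime⇒irreducible pq d∣q
... | inj₁ d≡1     = d≡1
... | inj₂ ≡.refl = contradiction d∣m q∤m

coprime-^ : ∀ {m q} → Coprime m q → ∀ k → Coprime m (q ^ k)
coprime-^ m⊥q zero    (_ , d∣1)          = ∣1⇒≡1 d∣1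
coprime-^ {q = q} m⊥q (suc k) {d} (d∣m , d∣q^[1+k]) = coprime-^ m⊥q k (d∣m , coprime-divisor d⊥q d∣q^[1+k])
  where
  d⊥q : Coprime d q
  d⊥q (e∣d , e∣q) = m⊥q (∣-trans e∣d d∣m , e∣q)

distinct-primes⇒coprime-^ : ∀ {p q} → Prime p → Prime q → p ≢ q → ∀ i j → Coprime (p ^ i) (q ^ j)
distinct-primes⇒coprime-^ {p} {q} pp pq p≢q i j =
  Coprimality.sym (coprime-^ (Coprimality.sym (coprime-^ p⊥q j)) i)
  where
  q∤p : ¬ q ∣ p
  q∤p q∣p with prime⇒irreducible pp q∣p
  ... | inj₁ ≡.refl = <-irrefl ≡.refl (prime⇒1< pq)
  ... | inj₂ q≡p    = p≢q (≡.sym q≡p)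
  p⊥q : Coprime p q
  p⊥q = prime∤⇒coprime pq q∤p

¬m^[1+n]∣m^n : ∀ {m} → 1 < m → ∀ n → ¬ m ^ suc n ∣ m ^ n
¬m^[1+n]∣m^n {m} 1<m n m^[1+n]∣m^n =
  <⇒≱ (^-monoʳ-< m 1<m (n<1+n n)) (∣⇒≤ {{m^n≢0 m n {{>-nonZero (≤-<-trans z≤n 1<m)}}}} m^[1+n]∣m^n)

-- s * n ≡ -1 (mod N) in the second Bézout case, and then s * (N - 1) inverts n.
coprime⇒invertible : ∀ {n N} → Coprime n N → ∃ λ s → ∃ λ a → ∃ λ b → 1 + a * N ≡ s * n + b * N
coprime⇒invertible n⊥N with coprime-Bézout n⊥N
... | Bézout.+- s t 1+tN≡sn = s , t , 0 , ≡.trans 1+tN≡sn (≡.sym (+-identityʳ _))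
coprime⇒invertible {n} {zero} n⊥N | Bézout.-+ s t 1+sn≡t*0 =
  contradiction (≡.trans 1+sn≡t*0 (*-zeroʳ t)) 1+n≢0
coprime⇒invertible {n} {suc M} n⊥N | Bézout.-+ s t 1+sn≡tN = s * M , t * M , 1 , (begin
  1 + t * M * suc M      ≡⟨ ≡.cong (1 +_) (solve (t ∷ M ∷ [])) ⟩
  1 + M * (t * suc M)    ≡⟨ ≡.cong (λ k → 1 + M * k) 1+sn≡tN ⟨
  1 + M * (1 + s * n)    ≡⟨ solve (s ∷ M ∷ n ∷ []) ⟩
  s * M * n + 1 * suc M  ∎)
  where open ≡.≡-Reasoning

module CyclicSubgroups {c ℓ : Level} (K : Group c ℓ) where
  open Group K
  open GroupNotions K
  open import Algebra.Properties.Group K using (∙-cancelˡ; x∙y⁻¹≈ε⇒x≈y; x≈y⇒x∙y⁻¹≈ε)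
  open import Algebra.Properties.Monoid.Mult monoid using (×-congʳ; ×-homo-+; ×-assocˡ)
    renaming (_×_ to _·_)
  open import Relation.Binary.Reasoning.Setoid setoid

  private
    variable
      v w x x' y z : Carrier
      k m n M N : ℕ

  pow≡· : ∀ x n → pow x n ≡ n · x
  pow≡· x zero    = ≡.refl
  pow≡· x (suc n) = ≡.cong (x ∙_) (pow≡· x n)

  pow-cong : ∀ n → x ≈ y → pow x n ≈ pow y n
  pow-cong {x} {y} n x≈y rewrite pow≡· x n | pow≡· y n = ×-congʳ n x≈y

  pow-+ : ∀ x m n → pow x (m + n) ≈ pow x m ∙ pow x n
  pow-+ x m n rewrite pow≡· x (m + n) | pow≡· x m | pow≡· x n = ×-homo-+ x m n

  pow-pow : ∀ x m n → pow (pow x m) n ≈ pow x (n * m)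
  pow-pow x m n rewrite pow≡· x m | pow≡· (m · x) n | pow≡· x (n * m) = ×-assocˡ x n m

  pow-pow′ : ∀ x m n → pow (pow x m) n ≈ pow x (m * n)
  pow-pow′ x m n = trans (pow-pow x m n) (reflexive (≡.cong (pow x) (*-comm n m)))

  pow-ε : ∀ n → pow ε n ≈ ε
  pow-ε zero    = refl
  pow-ε (suc n) = trans (identityˡ _) (pow-ε n)

  pow-linear-projection : ∀ {a b} → pow x a ≈ x → pow x b ≈ ε → ∀ m n → pow x (m * a + n * b) ≈ pow x m
  pow-linear-projection {x} {a} {b} xᵃ≈x xᵇ≈ε m n = begin
    pow x (m * a + n * b)                ≈⟨ pow-+ x (m * a) (n * b) ⟩
    pow x (m * a) ∙ pow x (n * b)        ≈⟨ ∙-cong (pow-pow x a m) (pow-pow x b n) ⟨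
    pow (pow x a) m ∙ pow (pow x b) n    ≈⟨ ∙-cong (pow-cong m xᵃ≈x) (pow-cong n xᵇ≈ε) ⟩
    pow x m ∙ pow ε n                    ≈⟨ ∙-congˡ (pow-ε n) ⟩
    pow x m ∙ ε                          ≈⟨ identityʳ _ ⟩
    pow x m                              ∎

  pow-multiple≈ε : pow x N ≈ ε → ∀ k → pow x (k * N) ≈ ε
  pow-multiple≈ε {x} {N} xᴺ≈ε k = begin
    pow x (k * N)    ≈⟨ pow-pow x N k ⟨
    pow (pow x N) k  ≈⟨ pow-cong k xᴺ≈ε ⟩
    pow ε k          ≈⟨ pow-ε k ⟩
    ε                ∎

  pow-+-multiple : pow x N ≈ ε → ∀ e k → pow x (e + k * N) ≈ pow x e
  pow-+-multiple {x} {N} xᴺ≈ε e k = begin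
    pow x (e + k * N)        ≈⟨ pow-+ x e (k * N) ⟩
    pow x e ∙ pow x (k * N)  ≈⟨ ∙-congˡ (pow-multiple≈ε xᴺ≈ε k) ⟩
    pow x e ∙ ε              ≈⟨ identityʳ _ ⟩
    pow x e                  ∎

  pow-mod : .{{_ : NonZero N}} → pow x N ≈ ε → ∀ n → pow x n ≈ pow x (n % N)
  pow-mod {N} {x} xᴺ≈ε n = begin
    pow x n                    ≡⟨ ≡.cong (pow x) (m≡m%n+[m/n]*n n N) ⟩
    pow x (n % N + n / N * N)  ≈⟨ pow-+-multiple xᴺ≈ε (n % N) (n / N) ⟩
    pow x (n % N)              ∎

  ∈⟨⟩-refl : ∀ x → x ∈⟨ x ⟩
  ∈⟨⟩-refl x = 1 , sym (identityʳ x)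

  ≈ε⇒∈⟨⟩ : x ≈ ε → x ∈⟨ y ⟩
  ≈ε⇒∈⟨⟩ x≈ε = 0 , x≈ε

  pow∈⟨⟩ : ∀ x n → pow x n ∈⟨ x ⟩
  pow∈⟨⟩ x n = n , refl

  ∈⟨⟩-trans : x ∈⟨ y ⟩ → y ∈⟨ z ⟩ → x ∈⟨ z ⟩
  ∈⟨⟩-trans {z = z} (m , x≈yᵐ) (n , y≈zⁿ) = m * n , trans x≈yᵐ (trans (pow-cong m y≈zⁿ) (pow-pow z n m))

  ∈⟨⟩-respˡ : x ≈ x' → x ∈⟨ y ⟩ → x' ∈⟨ y ⟩
  ∈⟨⟩-respˡ x≈x' (m , x≈yᵐ) = m , trans (sym x≈x') x≈yᵐ

  ∈⟨⟩-respʳ : y ≈ z → x ∈⟨ y ⟩ → x ∈⟨ z ⟩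
  ∈⟨⟩-respʳ y≈z (m , x≈yᵐ) = m , trans x≈yᵐ (pow-cong m y≈z)

  ∈⟨ε⟩⇒≈ε : x ∈⟨ ε ⟩ → x ≈ ε
  ∈⟨ε⟩⇒≈ε (m , x≈εᵐ) = trans x≈εᵐ (pow-ε m)

  ∈⟨⟩-pow≈ε : pow z N ≈ ε → x ∈⟨ z ⟩ → pow x N ≈ ε
  ∈⟨⟩-pow≈ε {z} {N} {x} zᴺ≈ε (m , x≈zᵐ) = begin
    pow x N          ≈⟨ pow-cong N x≈zᵐ ⟩
    pow (pow z m) N  ≈⟨ pow-pow′ z m N ⟩
    pow z (m * N)    ≈⟨ pow-multiple≈ε zᴺ≈ε m ⟩
    ε                ∎

  ∈⟨pow⟩-coprime : pow y N ≈ ε → Coprime n N → y ∈⟨ pow y n ⟩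
  ∈⟨pow⟩-coprime {y} {N} {n} yᴺ≈ε n⊥N with coprime⇒invertible n⊥N
  ... | s , a , b , 1+aN≡sn+bN = s , (begin
    y                        ≈⟨ identityʳ y ⟨
    pow y 1                  ≈⟨ pow-+-multiple yᴺ≈ε 1 a ⟨
    pow y (1 + a * N)        ≡⟨ ≡.cong (pow y) 1+aN≡sn+bN ⟩
    pow y (s * n + b * N)    ≈⟨ pow-+-multiple yᴺ≈ε (s * n) b ⟩
    pow y (s * n)            ≈⟨ pow-pow y n s ⟨
    pow (pow y n) s          ∎)

  ∈⟨⟩-bounded : .{{_ : NonZero N}} → pow x N ≈ ε → y ∈⟨ x ⟩ → Σ (Fin N) λ i → y ≈ pow x (toℕ i)
  ∈⟨⟩-bounded {N} {x} {y} xᴺ≈ε (n , y≈xⁿ) = fromℕ< (m%n<n n N) , (begin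
    y                                ≈⟨ y≈xⁿ ⟩
    pow x n                          ≈⟨ pow-mod xᴺ≈ε n ⟩
    pow x (n % N)                    ≡⟨ ≡.cong (pow x) (toℕ-fromℕ< (m%n<n n N)) ⟨
    pow x (toℕ (fromℕ< (m%n<n n N))) ∎)

  HasOrder-1⇒≈ε : HasOrder x 1 → x ≈ ε
  HasOrder-1⇒≈ε {x} (_ , x¹≈ε , _) = trans (sym (identityʳ x)) x¹≈ε

  HasOrder⇒∣ : HasOrder x N → pow x m ≈ ε → N ∣ m
  HasOrder⇒∣ {x} {N} {m} (0<N , xᴺ≈ε , minimal) xᵐ≈ε = m%n≡0⇒n∣m m N m%N≡0
    where
    instance
      N≢0 : NonZero N
      N≢0 = >-nonZero 0<N
    m%N≡0 : m % N ≡ 0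
    m%N≡0 = n≤0⇒n≡0 (≮⇒≥ λ 0<m%N →
      minimal (m % N) 0<m%N (m%n<n m N) (trans (sym (pow-mod xᴺ≈ε m)) xᵐ≈ε))

  HasOrder-∣-∈⟨⟩ : HasOrder w N → HasOrder z M → w ∈⟨ z ⟩ → N ∣ M
  HasOrder-∣-∈⟨⟩ {M = M} hw (_ , zᴹ≈ε , _) w∈⟨z⟩ = HasOrder⇒∣ hw (∈⟨⟩-pow≈ε {N = M} zᴹ≈ε w∈⟨z⟩)

  SameCyclic⇒order≡ : HasOrder w N → HasOrder z M → SameCyclic w z → N ≡ M
  SameCyclic⇒order≡ hw hz (w∈⟨z⟩ , z∈⟨w⟩) =
    ∣-antisym (HasOrder-∣-∈⟨⟩ hw hz w∈⟨z⟩) (HasOrder-∣-∈⟨⟩ hz hw z∈⟨w⟩)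

  HasOrder-pow : ∀ r → HasOrder w (r * N) → HasOrder (pow w r) N
  HasOrder-pow {w} {zero} r (0<r*0 , _) = contradiction (≡.subst (0 <_) (*-zeroʳ r) 0<r*0) λ ()
  HasOrder-pow {w} {N@(suc _)} r (0<r*N , wʳᴺ≈ε , minimal) = s≤s z≤n , wʳ^N≈ε , minimalʳ
    where
    instance
      r≢0 : NonZero r
      r≢0 = m*n≢0⇒m≢0 r {{>-nonZero 0<r*N}}
    wʳ^N≈ε : pow (pow w r) N ≈ ε
    wʳ^N≈ε = trans (pow-pow′ w r N) wʳᴺ≈ε
    minimalʳ : ∀ m → 0 < m → m < N → ¬ pow (pow w r) m ≈ ε
    minimalʳ m 0<m m<N wʳᵐ≈ε = minimal (r * m) (≤-<-trans z≤n (*-monoʳ-< r 0<m)) (*-monoʳ-< r m<N)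
      (trans (sym (pow-pow′ w r m)) wʳᵐ≈ε)

  pow-distinct : HasOrder w N → m < n → n < N → ¬ pow w m ≈ pow w n
  pow-distinct {w} {N} {m} {n} (_ , _ , minimal) m<n n<N wᵐ≈wⁿ =
    minimal (n ∸ m) (m<n⇒0<n∸m m<n) (≤-<-trans (m∸n≤m n m) n<N) (∙-cancelˡ (pow w m) _ _ (begin
      pow w m ∙ pow w (n ∸ m)  ≈⟨ pow-+ w m (n ∸ m) ⟨
      pow w (m + (n ∸ m))      ≡⟨ ≡.cong (pow w) (m+[n∸m]≡n (<⇒≤ m<n)) ⟩
      pow w n                  ≈⟨ wᵐ≈wⁿ ⟨
      pow w m                  ≈⟨ identityʳ _ ⟨
      pow w m ∙ ε              ∎))

  pow-injective : HasOrder w N → m < N → n < N → pow w m ≈ pow w n → m ≡ n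
  pow-injective {m = m} {n = n} hw m<N n<N wᵐ≈wⁿ with <-cmp m n
  ... | tri< m<n _ _ = contradiction wᵐ≈wⁿ (pow-distinct hw m<n n<N)
  ... | tri≈ _ m≡n _ = m≡n
  ... | tri> _ _ n<m = contradiction (sym wᵐ≈wⁿ) (pow-distinct hw n<m m<N)

  CardGE-mono : {S T : Carrier → Set ℓ} → (∀ v → S v → T v) → CardGE S k → CardGE T k
  CardGE-mono S⊆T (f , f∈S , f-injective) = f , (λ i → S⊆T (f i) (f∈S i)) , f-injective

  CardGE-⟨⟩ : HasOrder w N → CardGE (_∈⟨ w ⟩) N
  CardGE-⟨⟩ {w} hw = (λ i → pow w (toℕ i)) , (λ i → pow∈⟨⟩ w (toℕ i)) ,
    λ i j wⁱ≈wʲ → toℕ-injective (pow-injective hw (toℕ<n i) (toℕ<n j) wⁱ≈wʲ)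

  ¬CardGE-⟨⟩ : HasOrder w N → N < M → ¬ CardGE (_∈⟨ w ⟩) M
  ¬CardGE-⟨⟩ {w} {N} {M} (0<N , wᴺ≈ε , _) N<M (f , f∈⟨w⟩ , f-injective) =
    let i , j , i<j , same-index = pigeonhole N<M index
    in Fin.<-irrefl (f-injective i j (begin
      f i                      ≈⟨ f≈w^index i ⟩
      pow w (toℕ (index i))    ≡⟨ ≡.cong (pow w ∘ toℕ) same-index ⟩
      pow w (toℕ (index j))    ≈⟨ f≈w^index j ⟨
      f j                      ∎)) i<j
    where
    instance
      N≢0 : NonZero N
      N≢0 = >-nonZero 0<N
    index : Fin M → Fin N
    index i = proj₁ (∈⟨⟩-bounded wᴺ≈ε (f∈⟨w⟩ i))
    f≈w^index : ∀ i → f i ≈ pow w (toℕ (index i))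
    f≈w^index i = proj₂ (∈⟨⟩-bounded wᴺ≈ε (f∈⟨w⟩ i))

  infix 4 _⊂⟨_⟩
  _⊂⟨_⟩ : Carrier → Carrier → Set ℓ
  x ⊂⟨ y ⟩ = x ∈⟨ y ⟩ × ¬ y ∈⟨ x ⟩

  ⊂⟨⟩-irrefl : ¬ x ⊂⟨ x ⟩
  ⊂⟨⟩-irrefl {x} (_ , x∉⟨x⟩) = x∉⟨x⟩ (∈⟨⟩-refl x)

  ∈⟨⟩-⊂⟨⟩-trans : x ∈⟨ y ⟩ → y ⊂⟨ z ⟩ → x ⊂⟨ z ⟩
  ∈⟨⟩-⊂⟨⟩-trans x∈⟨y⟩ (y∈⟨z⟩ , z∉⟨y⟩) = ∈⟨⟩-trans x∈⟨y⟩ y∈⟨z⟩ , λ z∈⟨x⟩ → z∉⟨y⟩ (∈⟨⟩-trans z∈⟨x⟩ x∈⟨y⟩)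

  ⊂⟨⟩-∈⟨⟩-trans : x ⊂⟨ y ⟩ → y ∈⟨ z ⟩ → x ⊂⟨ z ⟩
  ⊂⟨⟩-∈⟨⟩-trans (x∈⟨y⟩ , y∉⟨x⟩) y∈⟨z⟩ = ∈⟨⟩-trans x∈⟨y⟩ y∈⟨z⟩ , λ z∈⟨x⟩ → y∉⟨x⟩ (∈⟨⟩-trans y∈⟨z⟩ z∈⟨x⟩)

  ε⊂⟨⟩ : ¬ y ≈ ε → ε ⊂⟨ y ⟩
  ε⊂⟨⟩ y≉ε = ≈ε⇒∈⟨⟩ refl , λ y∈⟨ε⟩ → y≉ε (∈⟨ε⟩⇒≈ε y∈⟨ε⟩)

  ¬⊂⟨ε⟩ : ¬ x ⊂⟨ ε ⟩
  ¬⊂⟨ε⟩ (_ , ε∉⟨x⟩) = ε∉⟨x⟩ (≈ε⇒∈⟨⟩ refl)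

  EnhAdj-sym : EnhAdj x y → EnhAdj y x
  EnhAdj-sym (x≉y , z , x∈⟨z⟩ , y∈⟨z⟩) = x≉y ∘ sym , z , y∈⟨z⟩ , x∈⟨z⟩

  PowAdj-sym : PowAdj x y → PowAdj y x
  PowAdj-sym (x≉y , comparable) = x≉y ∘ sym , Sum.swap comparable

  DAdj-sym : DAdj x y → DAdj y x
  DAdj-sym (enhanced , ¬power) = EnhAdj-sym enhanced , ¬power ∘ PowAdj-sym

  IsPGroup⇒torsion : ∀ {r} → IsPGroup r → ∀ x → ∃ λ N → HasOrder x N
  IsPGroup⇒torsion {r} r-group x = Product.map (r ^_) id (r-group x)

  module _ (torsion : ∀ x → ∃ λ N → HasOrder x N) where

    ≈ε? : ∀ x → Dec (x ≈ ε)
    ≈ε? x with torsion x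
    ... | zero        , (() , _)
    ... | 1           , hx                 = yes (HasOrder-1⇒≈ε hx)
    ... | suc (suc _) , (_ , _ , minimal)  = no (minimal 1 (s≤s z≤n) (s≤s (s≤s z≤n)) ∘ trans (identityʳ x))

    ≈? : ∀ x y → Dec (x ≈ y)
    ≈? x y = map′ (x∙y⁻¹≈ε⇒x≈y x y) x≈y⇒x∙y⁻¹≈ε (≈ε? (x ∙ y ⁻¹))

    ∈⟨⟩? : ∀ y x → Dec (y ∈⟨ x ⟩)
    ∈⟨⟩? y x with torsion x
    ... | N , (0<N , xᴺ≈ε , _) =
      map′ (λ (i , y≈xⁱ) → toℕ i , y≈xⁱ) (∈⟨⟩-bounded xᴺ≈ε) (any? λ i → ≈? y (pow x (toℕ i)))
      where
      instance
        N≢0 : NonZero N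
        N≢0 = >-nonZero 0<N

    ¬InM⇒⊂⟨⟩ : IsFinite → ¬ InM x → ∃ λ y → x ⊂⟨ y ⟩
    ¬InM⇒⊂⟨⟩ {x} (n , f , f-surjective) ¬InM-x with any? (λ i → ∈⟨⟩? x (f i) ×-dec ¬? (∈⟨⟩? (f i) x))
    ... | yes (i , x⊂⟨fi⟩) = f i , x⊂⟨fi⟩
    ... | no ¬∃⊂           = contradiction InM-x ¬InM-x
      where
      InM-x : InM x
      InM-x y x∈⟨y⟩ with f-surjective y
      ... | i , y≈fi with ∈⟨⟩? (f i) x
      ...   | yes fi∈⟨x⟩ = ∈⟨⟩-respˡ (sym y≈fi) fi∈⟨x⟩
      ...   | no fi∉⟨x⟩  = contradiction (i , ∈⟨⟩-respʳ y≈fi x∈⟨y⟩ , fi∉⟨x⟩) ¬∃⊂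

  module _ {r} (pr : Prime r) where

    ∈⟨⟩⇒generates⊎∈⟨pow⟩ : pow z (r ^ k) ≈ ε → x ∈⟨ z ⟩ → z ∈⟨ x ⟩ ⊎ x ∈⟨ pow z r ⟩
    ∈⟨⟩⇒generates⊎∈⟨pow⟩ {z} {k} {x} zᴺ≈ε (m , x≈zᵐ) with r ∣? m
    ... | yes (divides t m≡t*r) = inj₂ (t , (begin
      x                ≈⟨ x≈zᵐ ⟩
      pow z m          ≡⟨ ≡.cong (pow z) m≡t*r ⟩
      pow z (t * r)    ≈⟨ pow-pow z r t ⟨
      pow (pow z r) t  ∎))
    ... | no r∤m = inj₁ (∈⟨⟩-respʳ (sym x≈zᵐ)
      (∈⟨pow⟩-coprime {N = r ^ k} zᴺ≈ε (coprime-^ (prime∤⇒coprime pr r∤m) k)))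

    ∈⟨⟩-total : HasOrder z (r ^ k) → x ∈⟨ z ⟩ → x' ∈⟨ z ⟩ → x ∈⟨ x' ⟩ ⊎ x' ∈⟨ x ⟩
    ∈⟨⟩-total {k = zero} hz x∈⟨z⟩ _ =
      inj₁ (≈ε⇒∈⟨⟩ (∈⟨ε⟩⇒≈ε (∈⟨⟩-respʳ (HasOrder-1⇒≈ε hz) x∈⟨z⟩)))
    ∈⟨⟩-total {k = suc k} hz@(_ , zᴺ≈ε , _) x∈⟨z⟩ x'∈⟨z⟩
      with ∈⟨⟩⇒generates⊎∈⟨pow⟩ {k = suc k} zᴺ≈ε x∈⟨z⟩ | ∈⟨⟩⇒generates⊎∈⟨pow⟩ {k = suc k} zᴺ≈ε x'∈⟨z⟩
    ... | inj₁ z∈⟨x⟩  | _              = inj₂ (∈⟨⟩-trans x'∈⟨z⟩ z∈⟨x⟩)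
    ... | inj₂ _      | inj₁ z∈⟨x'⟩    = inj₁ (∈⟨⟩-trans x∈⟨z⟩ z∈⟨x'⟩)
    ... | inj₂ x∈⟨zʳ⟩ | inj₂ x'∈⟨zʳ⟩   = ∈⟨⟩-total {k = k} (HasOrder-pow r hz) x∈⟨zʳ⟩ x'∈⟨zʳ⟩

    ¬∈⟨pow⟩-same-order : HasOrder w (r ^ suc k) → HasOrder z (r ^ suc k) → ¬ w ∈⟨ pow z r ⟩
    ¬∈⟨pow⟩-same-order {k = k} hw hz w∈⟨zʳ⟩ =
      ¬m^[1+n]∣m^n (prime⇒1< pr) k (HasOrder-∣-∈⟨⟩ hw (HasOrder-pow r hz) w∈⟨zʳ⟩)

    pow⊂⟨⟩ : HasOrder w (r ^ suc k) → pow w r ⊂⟨ w ⟩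
    pow⊂⟨⟩ {w} {k} hw = pow∈⟨⟩ w r , ¬∈⟨pow⟩-same-order {k = k} hw hw

    ⊂⟨⟩⇔∈⟨pow⟩ : HasOrder w (r ^ suc k) → x ⊂⟨ w ⟩ ⇔ x ∈⟨ pow w r ⟩
    ⊂⟨⟩⇔∈⟨pow⟩ {k = k} hw@(_ , wᴺ≈ε , _) = mk⇔
      (λ (x∈⟨w⟩ , w∉⟨x⟩) → fromInj₂ (⊥-elim ∘ w∉⟨x⟩) (∈⟨⟩⇒generates⊎∈⟨pow⟩ {k = suc k} wᴺ≈ε x∈⟨w⟩))
      (λ x∈⟨wʳ⟩ → ∈⟨⟩-⊂⟨⟩-trans x∈⟨wʳ⟩ (pow⊂⟨⟩ {k = k} hw))

    same-order-∈⟨⟩⇒SameCyclic : HasOrder w (r ^ k) → HasOrder z (r ^ k) → w ∈⟨ z ⟩ → SameCyclic w z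
    same-order-∈⟨⟩⇒SameCyclic {k = zero} _ hz w∈⟨z⟩ = w∈⟨z⟩ , ≈ε⇒∈⟨⟩ (HasOrder-1⇒≈ε hz)
    same-order-∈⟨⟩⇒SameCyclic {k = suc k} hw hz@(_ , zᴺ≈ε , _) w∈⟨z⟩ =
      w∈⟨z⟩ , fromInj₁ (⊥-elim ∘ ¬∈⟨pow⟩-same-order {k = k} hw hz)
                       (∈⟨⟩⇒generates⊎∈⟨pow⟩ {k = suc k} zᴺ≈ε w∈⟨z⟩)

    pow∈⟨⟩⇒same-⊂⟨⟩ : HasOrder w (r ^ suc k) → HasOrder z (r ^ suc k) → pow w r ∈⟨ z ⟩ →
                      ∀ v → v ⊂⟨ w ⟩ ⇔ v ⊂⟨ z ⟩
    pow∈⟨⟩⇒same-⊂⟨⟩ {w} {k} {z} hw hz wʳ∈⟨z⟩ v = mk⇔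
      (λ v⊂⟨w⟩ → from (⊂⟨⟩⇔∈⟨pow⟩ {k = k} hz) (∈⟨⟩-trans (to (⊂⟨⟩⇔∈⟨pow⟩ {k = k} hw) v⊂⟨w⟩) wʳ∈⟨zʳ⟩))
      (λ v⊂⟨z⟩ → from (⊂⟨⟩⇔∈⟨pow⟩ {k = k} hw) (∈⟨⟩-trans (to (⊂⟨⟩⇔∈⟨pow⟩ {k = k} hz) v⊂⟨z⟩) zʳ∈⟨wʳ⟩))
      where
      wʳ∈⟨zʳ⟩ : pow w r ∈⟨ pow z r ⟩
      wʳ∈⟨zʳ⟩ = to (⊂⟨⟩⇔∈⟨pow⟩ {k = k} hz) (wʳ∈⟨z⟩ , ¬∈⟨pow⟩-same-order {k = k} hz hw)
      zʳ∈⟨wʳ⟩ : pow z r ∈⟨ pow w r ⟩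
      zʳ∈⟨wʳ⟩ = proj₂ (same-order-∈⟨⟩⇒SameCyclic {k = k} (HasOrder-pow r hw) (HasOrder-pow r hz) wʳ∈⟨zʳ⟩)

    module _ (r-group : IsPGroup r) where

      ∈⟨⟩⇒SameCyclic⊎⊂⟨⟩ : x ∈⟨ z ⟩ → SameCyclic x z ⊎ x ⊂⟨ z ⟩
      ∈⟨⟩⇒SameCyclic⊎⊂⟨⟩ {x} {z} x∈⟨z⟩ with r-group z
      ... | zero  , hz                 = inj₁ (x∈⟨z⟩ , ≈ε⇒∈⟨⟩ (HasOrder-1⇒≈ε hz))
      ... | suc k , hz@(_ , zᴺ≈ε , _) =
        Sum.map (x∈⟨z⟩ ,_) (from (⊂⟨⟩⇔∈⟨pow⟩ {k = k} hz)) (∈⟨⟩⇒generates⊎∈⟨pow⟩ {k = suc k} zᴺ≈ε x∈⟨z⟩)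

      cyclic-trichotomy : x ∈⟨ z ⟩ → x' ∈⟨ z ⟩ → SameCyclic x x' ⊎ x ⊂⟨ x' ⟩ ⊎ x' ⊂⟨ x ⟩
      cyclic-trichotomy {z = z} x∈⟨z⟩ x'∈⟨z⟩
        with ∈⟨⟩-total {k = proj₁ (r-group z)} (proj₂ (r-group z)) x∈⟨z⟩ x'∈⟨z⟩
      ... | inj₁ x∈⟨x'⟩ = Sum.map₂ inj₁ (∈⟨⟩⇒SameCyclic⊎⊂⟨⟩ x∈⟨x'⟩)
      ... | inj₂ x'∈⟨x⟩ = Sum.map swap inj₂ (∈⟨⟩⇒SameCyclic⊎⊂⟨⟩ x'∈⟨x⟩)

      same-⊂⟨⟩⇒same-order : HasOrder w (r ^ suc k) → (∀ v → v ⊂⟨ w ⟩ ⇔ v ⊂⟨ z ⟩) → HasOrder z (r ^ suc k)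
      same-⊂⟨⟩⇒same-order {w} {k} {z} hw same with r-group z
      ... | zero , hz =
        contradiction (≈ε⇒∈⟨⟩ (HasOrder-1⇒≈ε hz)) (proj₂ (to (same (pow w r)) (pow⊂⟨⟩ {k = k} hw)))
      ... | suc j , hz = ≡.subst (λ n → HasOrder z (r * n)) (≡.sym rᵏ≡rʲ) hz
        where
        wʳ∈⟨zʳ⟩ : pow w r ∈⟨ pow z r ⟩
        wʳ∈⟨zʳ⟩ = to (⊂⟨⟩⇔∈⟨pow⟩ {k = j} hz) (to (same (pow w r)) (pow⊂⟨⟩ {k = k} hw))
        zʳ∈⟨wʳ⟩ : pow z r ∈⟨ pow w r ⟩
        zʳ∈⟨wʳ⟩ = to (⊂⟨⟩⇔∈⟨pow⟩ {k = k} hw) (from (same (pow z r)) (pow⊂⟨⟩ {k = j} hz))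
        rᵏ≡rʲ : r ^ k ≡ r ^ j
        rᵏ≡rʲ = SameCyclic⇒order≡ (HasOrder-pow r hw) (HasOrder-pow r hz) (wʳ∈⟨zʳ⟩ , zʳ∈⟨wʳ⟩)

      -- If w ^ r ∉ ⟨z⟩, then ⟨w⟩ ∩ ⟨z⟩ ⊆ ⟨(w ^ r) ^ r⟩, which has only r ^ (k - 1) elements.
      large-∩⇒pow∈⟨⟩ : HasOrder w (r ^ suc k) → CardGE (λ v → v ∈⟨ w ⟩ × v ∈⟨ z ⟩) (r ^ k) → pow w r ∈⟨ z ⟩
      large-∩⇒pow∈⟨⟩ {k = zero} hw _ = ≈ε⇒∈⟨⟩ (HasOrder-1⇒≈ε (HasOrder-pow r hw))
      large-∩⇒pow∈⟨⟩ {w} {suc k} {z} hw large with ∈⟨⟩? (IsPGroup⇒torsion r-group) (pow w r) z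
      ... | yes wʳ∈⟨z⟩ = wʳ∈⟨z⟩
      ... | no wʳ∉⟨z⟩  = contradiction (CardGE-mono in⟨wʳʳ⟩ large)
                           (¬CardGE-⟨⟩ (HasOrder-pow r hwʳ) (^-monoʳ-< r (prime⇒1< pr) (n<1+n k)))
        where
        hwʳ : HasOrder (pow w r) (r ^ suc k)
        hwʳ = HasOrder-pow r hw
        in⟨wʳʳ⟩ : ∀ v → v ∈⟨ w ⟩ × v ∈⟨ z ⟩ → v ∈⟨ pow (pow w r) r ⟩
        in⟨wʳʳ⟩ v (v∈⟨w⟩ , v∈⟨z⟩) =
          to (⊂⟨⟩⇔∈⟨pow⟩ {k = k} hwʳ) (v∈⟨wʳ⟩ , λ wʳ∈⟨v⟩ → wʳ∉⟨z⟩ (∈⟨⟩-trans wʳ∈⟨v⟩ v∈⟨z⟩))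
          where
          v∈⟨wʳ⟩ : v ∈⟨ pow w r ⟩
          v∈⟨wʳ⟩ = to (⊂⟨⟩⇔∈⟨pow⟩ {k = suc k} hw)
            (v∈⟨w⟩ , λ w∈⟨v⟩ → wʳ∉⟨z⟩ (∈⟨⟩-trans (pow∈⟨⟩ w r) (∈⟨⟩-trans w∈⟨v⟩ v∈⟨z⟩)))

module DirectProduct {c₁ ℓ₁ c₂ ℓ₂ : Level} (K : Group c₁ ℓ₁) (L : Group c₂ ℓ₂) where
  private
    module K where
      open Group K public
      open CyclicSubgroups K public
      open GroupNotions K public
    module L where
      open Group L public
      open CyclicSubgroups L public
      open GroupNotions L public
    module G = GroupNotions (group K L)
    variable
      g x : K.Carrier
      h y : L.Carrier
      M N : ℕ

  pow-proj₁ : ∀ g h n → proj₁ (G.pow (g , h) n) ≡ K.pow g n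
  pow-proj₁ g h zero    = ≡.refl
  pow-proj₁ g h (suc n) = ≡.cong (g K.∙_) (pow-proj₁ g h n)

  pow-proj₂ : ∀ g h n → proj₂ (G.pow (g , h) n) ≡ L.pow h n
  pow-proj₂ g h zero    = ≡.refl
  pow-proj₂ g h (suc n) = ≡.cong (h L.∙_) (pow-proj₂ g h n)

  ∈⟨,⟩⇒ : (x , y) G.∈⟨ (g , h) ⟩ → x K.∈⟨ g ⟩ × y L.∈⟨ h ⟩
  ∈⟨,⟩⇒ {x} {y} {g} {h} (n , x≈gⁿ , y≈hⁿ) =
    (n , ≡.subst (x K.≈_) (pow-proj₁ g h n) x≈gⁿ) , (n , ≡.subst (y L.≈_) (pow-proj₂ g h n) y≈hⁿ)

  -- e solves e ≡ m (mod N), e ≡ n (mod M) by the Chinese remainder theorem.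
  ∈⟨,⟩⇐ : K.pow g N K.≈ K.ε → L.pow h M L.≈ L.ε → Coprime N M →
          x K.∈⟨ g ⟩ → y L.∈⟨ h ⟩ → (x , y) G.∈⟨ (g , h) ⟩
  ∈⟨,⟩⇐ {g} {N} {h} {M} {x} {y} gᴺ≈ε hᴹ≈ε N⊥M (m , x≈gᵐ) (n , y≈hⁿ)
    with K.∈⟨pow⟩-coprime {N = N} gᴺ≈ε (Coprimality.sym N⊥M) | L.∈⟨pow⟩-coprime {N = M} hᴹ≈ε N⊥M
  ... | s , g≈gᴹˢ | t , h≈hᴺᵗ =
    e , ≡.subst (x K.≈_) (≡.sym (pow-proj₁ g h e)) (K.trans x≈gᵐ (K.sym gᵉ≈gᵐ))
      , ≡.subst (y L.≈_) (≡.sym (pow-proj₂ g h e)) (L.trans y≈hⁿ (L.sym hᵉ≈hⁿ))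
    where
    e : ℕ
    e = m * (s * M) + n * (t * N)
    gᵉ≈gᵐ : K.pow g e K.≈ K.pow g m
    gᵉ≈gᵐ =
      K.pow-linear-projection (K.sym (K.trans g≈gᴹˢ (K.pow-pow g M s))) (K.pow-multiple≈ε gᴺ≈ε t) m n
    hᵉ≈hⁿ : L.pow h e L.≈ L.pow h n
    hᵉ≈hⁿ = L.trans (L.reflexive (≡.cong (L.pow h) (+-comm (m * (s * M)) (n * (t * N)))))
      (L.pow-linear-projection (L.sym (L.trans h≈hᴺᵗ (L.pow-pow h N t))) (L.pow-multiple≈ε hᴹ≈ε s) n m)

module ProductOfCoprimePGroups {c ℓ : Level} {p q : ℕ} (pp : Prime p) (pq : Prime q) (p≢q : p ≢ q)
    (K L : Group c ℓ) (K-pgroup : GroupNotions.IsPGroup K p) (L-qgroup : GroupNotions.IsPGroup L q) where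
  private
    module K where
      open Group K public
      open CyclicSubgroups K public
      open GroupNotions K public
    module L where
      open Group L public
      open CyclicSubgroups L public
      open GroupNotions L public
    module G where
      open GroupNotions (group K L) public
      open CyclicSubgroups (group K L) public using (DAdj-sym)
    variable
      x x' : K.Carrier
      y y' : L.Carrier
      v w : K.Carrier × L.Carrier

  open DirectProduct K L

  ∈⟨,⟩⇔ : (x , y) G.∈⟨ (x' , y') ⟩ ⇔ (x K.∈⟨ x' ⟩ × y L.∈⟨ y' ⟩)
  ∈⟨,⟩⇔ {x' = x'} {y' = y'} with K-pgroup x' | L-qgroup y'
  ... | i , (_ , x'ᴺ≈ε , _) | j , (_ , y'ᴹ≈ε , _) =
    mk⇔ ∈⟨,⟩⇒ λ (x∈⟨x'⟩ , y∈⟨y'⟩) →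
      ∈⟨,⟩⇐ x'ᴺ≈ε y'ᴹ≈ε (distinct-primes⇒coprime-^ pp pq p≢q i j) x∈⟨x'⟩ y∈⟨y'⟩

  Crossed : K.Carrier × L.Carrier → K.Carrier × L.Carrier → Set ℓ
  Crossed v w = proj₁ v K.⊂⟨ proj₁ w ⟩ × proj₂ w L.⊂⟨ proj₂ v ⟩

  Crossed⇒DAdj : Crossed v w → G.DAdj v w
  Crossed⇒DAdj {x , y} {x' , y'} ((x∈⟨x'⟩ , x'∉⟨x⟩) , (y'∈⟨y⟩ , y∉⟨y'⟩)) =
    ( (λ (x≈x' , _) → x'∉⟨x⟩ (K.∈⟨⟩-respˡ x≈x' (K.∈⟨⟩-refl x)))
    , (x' , y) , from ∈⟨,⟩⇔ (x∈⟨x'⟩ , L.∈⟨⟩-refl y) , from ∈⟨,⟩⇔ (K.∈⟨⟩-refl x' , y'∈⟨y⟩))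
    , λ { (_ , inj₁ w∈⟨v⟩) → x'∉⟨x⟩ (proj₁ (∈⟨,⟩⇒ w∈⟨v⟩))
        ; (_ , inj₂ v∈⟨w⟩) → y∉⟨y'⟩ (proj₂ (∈⟨,⟩⇒ v∈⟨w⟩)) }

  DAdj⇒Crossed⊎Crossed : G.DAdj v w → Crossed v w ⊎ Crossed w v
  DAdj⇒Crossed⊎Crossed {x , y} {x' , y'} ((v≉w , (z₁ , z₂) , v∈⟨z⟩ , w∈⟨z⟩) , ¬power)
    with ∈⟨,⟩⇒ v∈⟨z⟩ | ∈⟨,⟩⇒ w∈⟨z⟩
  ... | x∈⟨z₁⟩ , y∈⟨z₂⟩ | x'∈⟨z₁⟩ , y'∈⟨z₂⟩ =
    cases (K.∈⟨⟩-total pp {k = proj₁ (K-pgroup z₁)} (proj₂ (K-pgroup z₁)) x∈⟨z₁⟩ x'∈⟨z₁⟩)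
          (L.∈⟨⟩-total pq {k = proj₁ (L-qgroup z₂)} (proj₂ (L-qgroup z₂)) y∈⟨z₂⟩ y'∈⟨z₂⟩)
    where
    v∉⟨w⟩ : ¬ (x K.∈⟨ x' ⟩ × y L.∈⟨ y' ⟩)
    v∉⟨w⟩ = ¬power ∘ (v≉w ,_) ∘ inj₂ ∘ from ∈⟨,⟩⇔
    w∉⟨v⟩ : ¬ (x' K.∈⟨ x ⟩ × y' L.∈⟨ y ⟩)
    w∉⟨v⟩ = ¬power ∘ (v≉w ,_) ∘ inj₁ ∘ from ∈⟨,⟩⇔
    cases : x K.∈⟨ x' ⟩ ⊎ x' K.∈⟨ x ⟩ → y L.∈⟨ y' ⟩ ⊎ y' L.∈⟨ y ⟩ →
            Crossed (x , y) (x' , y') ⊎ Crossed (x' , y') (x , y)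
    cases (inj₁ x∈⟨x'⟩) (inj₁ y∈⟨y'⟩) = ⊥-elim (v∉⟨w⟩ (x∈⟨x'⟩ , y∈⟨y'⟩))
    cases (inj₂ x'∈⟨x⟩) (inj₂ y'∈⟨y⟩) = ⊥-elim (w∉⟨v⟩ (x'∈⟨x⟩ , y'∈⟨y⟩))
    cases (inj₁ x∈⟨x'⟩) (inj₂ y'∈⟨y⟩) =
      inj₁ ((x∈⟨x'⟩ , λ x'∈⟨x⟩ → w∉⟨v⟩ (x'∈⟨x⟩ , y'∈⟨y⟩)) , (y'∈⟨y⟩ , λ y∈⟨y'⟩ → v∉⟨w⟩ (x∈⟨x'⟩ , y∈⟨y'⟩)))
    cases (inj₂ x'∈⟨x⟩) (inj₁ y∈⟨y'⟩) =
      inj₂ ((x'∈⟨x⟩ , λ x∈⟨x'⟩ → v∉⟨w⟩ (x∈⟨x'⟩ , y∈⟨y'⟩)) , (y∈⟨y'⟩ , λ y'∈⟨y⟩ → w∉⟨v⟩ (x'∈⟨x⟩ , y'∈⟨y⟩)))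

  DAdj⇔ : G.DAdj v w ⇔ (Crossed v w ⊎ Crossed w v)
  DAdj⇔ = mk⇔ DAdj⇒Crossed⊎Crossed Sum.[ Crossed⇒DAdj , G.DAdj-sym ∘ Crossed⇒DAdj ]

  DAdj-maximal : L.InM (proj₂ v) → G.DAdj v w → Crossed v w
  DAdj-maximal v₂∈M = fromInj₁ (λ (_ , v₂∈⟨w₂⟩ , w₂∉⟨v₂⟩) → ⊥-elim (w₂∉⟨v₂⟩ (v₂∈M _ v₂∈⟨w₂⟩))) ∘ to DAdj⇔

  module NeighbourhoodClass (K-finite : K.IsFinite) (a : K.Carrier) (b : L.Carrier) (u : ℕ)
      (a≉ε : ¬ a K.≈ K.ε) (b≉ε : ¬ b L.≈ L.ε) (a∉M : ¬ K.InM a)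
      (b-order : L.HasOrder b (q ^ suc u)) (b∈M : L.InM b) where

    private
      a⊂⟨a'⟩ : ∃ λ a' → a K.⊂⟨ a' ⟩
      a⊂⟨a'⟩ = K.¬InM⇒⊂⟨⟩ (K.IsPGroup⇒torsion K-pgroup) K-finite a∉M
      a' : K.Carrier
      a' = proj₁ a⊂⟨a'⟩
      a⊂a' : a K.⊂⟨ a' ⟩
      a⊂a' = proj₂ a⊂⟨a'⟩

    -- b has order q ^ (1 + u) here, so u is one less than the u of the paper.
    Description : K.Carrier → L.Carrier → Set (c ⊔ ℓ)
    Description x y = K.SameCyclic x a × L.HasOrder y (q ^ suc u)
                    × L.CardGE (λ z → z L.∈⟨ b ⟩ × z L.∈⟨ y ⟩) (q ^ u) × L.InM y

    module SameNeighbourhood {x y} (same-nbhd : ∀ w → G.DAdj (x , y) w ⇔ G.DAdj (a , b) w) where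

      shared : ∀ {w} → Crossed (a , b) w → Crossed (x , y) w ⊎ Crossed w (x , y)
      shared {w} = to DAdj⇔ ∘ from (same-nbhd w) ∘ from DAdj⇔ ∘ inj₁
      shared⁻¹ : ∀ {w} → Crossed (x , y) w ⊎ Crossed w (x , y) → Crossed (a , b) w
      shared⁻¹ {w} = DAdj-maximal b∈M ∘ to (same-nbhd w) ∘ from DAdj⇔

      x⊂a'×ε⊂y : x K.⊂⟨ a' ⟩ × L.ε L.⊂⟨ y ⟩
      x⊂a'×ε⊂y = fromInj₁ (λ (_ , y⊂ε) → ⊥-elim (L.¬⊂⟨ε⟩ y⊂ε)) (shared (a⊂a' , L.ε⊂⟨⟩ b≉ε))
      x⊂a' : x K.⊂⟨ a' ⟩
      x⊂a' = proj₁ x⊂a'×ε⊂y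
      ε⊂y : L.ε L.⊂⟨ y ⟩
      ε⊂y = proj₂ x⊂a'×ε⊂y

      ¬x⊂a : ¬ x K.⊂⟨ a ⟩
      ¬x⊂a x⊂a = K.⊂⟨⟩-irrefl (proj₁ (shared⁻¹ (inj₁ (x⊂a , ε⊂y))))
      ¬a⊂x : ¬ a K.⊂⟨ x ⟩
      ¬a⊂x a⊂x = Sum.[ K.⊂⟨⟩-irrefl ∘ proj₁ , K.⊂⟨⟩-irrefl ∘ proj₁ ] (shared (a⊂x , L.ε⊂⟨⟩ b≉ε))

      x~a : K.SameCyclic x a
      x~a = fromInj₁ (⊥-elim ∘ Sum.[ ¬x⊂a , ¬a⊂x ])
                     (K.cyclic-trichotomy pp K-pgroup (proj₁ x⊂a') (proj₁ a⊂a'))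

      y∈M : L.InM y
      y∈M y' y∈⟨y'⟩ = Sum.[ proj₂ , (λ y⊂y' → ⊥-elim (K.¬⊂⟨ε⟩ (proj₁ (shared⁻¹ (inj₂ (ε⊂x , y⊂y')))))) ]
                        (L.∈⟨⟩⇒SameCyclic⊎⊂⟨⟩ pq L-qgroup y∈⟨y'⟩)
        where
        ε⊂x : K.ε K.⊂⟨ x ⟩
        ε⊂x = K.⊂⟨⟩-∈⟨⟩-trans (K.ε⊂⟨⟩ a≉ε) (proj₂ x~a)

      same-⊂ : ∀ v → v L.⊂⟨ b ⟩ ⇔ v L.⊂⟨ y ⟩
      same-⊂ v = mk⇔
        (λ v⊂b → proj₂ (fromInj₁ (λ (a'⊂x , _) → ⊥-elim (proj₂ x⊂a' (proj₁ a'⊂x))) (shared (a⊂a' , v⊂b))))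
        (λ v⊂y → proj₂ (shared⁻¹ (inj₁ (x⊂a' , v⊂y))))

      y-order : L.HasOrder y (q ^ suc u)
      y-order = L.same-⊂⟨⟩⇒same-order pq L-qgroup {k = u} b-order same-⊂

      ∩-large : L.CardGE (λ z → z L.∈⟨ b ⟩ × z L.∈⟨ y ⟩) (q ^ u)
      ∩-large = L.CardGE-mono ⟨bᵠ⟩⊆⟨b⟩∩⟨y⟩ (L.CardGE-⟨⟩ (L.HasOrder-pow q b-order))
        where
        bᵠ∈⟨y⟩ : L.pow b q L.∈⟨ y ⟩
        bᵠ∈⟨y⟩ = proj₁ (to (same-⊂ (L.pow b q)) (L.pow⊂⟨⟩ pq {k = u} b-order))
        ⟨bᵠ⟩⊆⟨b⟩∩⟨y⟩ : ∀ z → z L.∈⟨ L.pow b q ⟩ → z L.∈⟨ b ⟩ × z L.∈⟨ y ⟩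
        ⟨bᵠ⟩⊆⟨b⟩∩⟨y⟩ z z∈⟨bᵠ⟩ = L.∈⟨⟩-trans z∈⟨bᵠ⟩ (L.pow∈⟨⟩ b q) , L.∈⟨⟩-trans z∈⟨bᵠ⟩ bᵠ∈⟨y⟩

    InNbhdClass⇒Description : G.InNbhdClass (a , b) (x , y) → Description x y
    InNbhdClass⇒Description (_ , same-nbhd) = x~a , y-order , ∩-large , y∈M
      where open SameNeighbourhood same-nbhd

    Description⇒InNbhdClass : Description x y → G.InNbhdClass (a , b) (x , y)
    Description⇒InNbhdClass {x} {y} (x~a , y-order , ∩-large , y∈M) = ((a' , L.ε) , vertex) , same-nbhd
      where
      same-⊂ : ∀ v → v L.⊂⟨ b ⟩ ⇔ v L.⊂⟨ y ⟩
      same-⊂ = L.pow∈⟨⟩⇒same-⊂⟨⟩ pq {k = u} b-order y-order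
                 (L.large-∩⇒pow∈⟨⟩ pq L-qgroup {k = u} b-order ∩-large)
      vertex : G.DAdj (x , y) (a' , L.ε)
      vertex = from DAdj⇔ (inj₁ (K.∈⟨⟩-⊂⟨⟩-trans (proj₁ x~a) a⊂a' , to (same-⊂ L.ε) (L.ε⊂⟨⟩ b≉ε)))
      same-nbhd : ∀ w → G.DAdj (x , y) w ⇔ G.DAdj (a , b) w
      same-nbhd w = mk⇔
        (from DAdj⇔ ∘ inj₁ ∘ Product.map (K.∈⟨⟩-⊂⟨⟩-trans (proj₂ x~a)) (from (same-⊂ _)) ∘ DAdj-maximal y∈M)
        (from DAdj⇔ ∘ inj₁ ∘ Product.map (K.∈⟨⟩-⊂⟨⟩-trans (proj₁ x~a)) (to (same-⊂ _)) ∘ DAdj-maximal b∈M)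

lemma3p6 : {c ℓ : Level} (p q : ℕ) → Prime p → Prime q → ¬ (p ≡ q)
  → (P Q : AbelianGroup c ℓ)
  → GroupNotions.IsFinite (AbelianGroup.group P) → GroupNotions.IsPGroup (AbelianGroup.group P) p
  → GroupNotions.IsFinite (AbelianGroup.group Q) → GroupNotions.IsPGroup (AbelianGroup.group Q) q
  → (a : AbelianGroup.Carrier P) (b : AbelianGroup.Carrier Q) (u : ℕ)
  → ¬ (AbelianGroup._≈_ P a (AbelianGroup.ε P))
  → ¬ (AbelianGroup._≈_ Q b (AbelianGroup.ε Q))
  → ¬ GroupNotions.InM (AbelianGroup.group P) a
  → GroupNotions.HasOrder (AbelianGroup.group Q) b (q ^ u)
  → GroupNotions.InM (AbelianGroup.group Q) b
  → (x : AbelianGroup.Carrier P) (y : AbelianGroup.Carrier Q)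
  → GroupNotions.InNbhdClass (AbelianGroup.group (abelianGroup P Q)) (a , b) (x , y)
    ⇔ (GroupNotions.SameCyclic (AbelianGroup.group P) x a
       × GroupNotions.HasOrder (AbelianGroup.group Q) y (q ^ u)
       × GroupNotions.CardGE (AbelianGroup.group Q)
           (λ z → GroupNotions._∈⟨_⟩ (AbelianGroup.group Q) z b
                  × GroupNotions._∈⟨_⟩ (AbelianGroup.group Q) z y)
           (q ^ (u ∸ 1))
       × GroupNotions.InM (AbelianGroup.group Q) y)
lemma3p6 p q pp pq p≢q P Q P-finite P-pgroup _ Q-pgroup a b zero a≉ε b≉ε a∉M b-order b∈M x y =
  ⊥-elim (b≉ε (CyclicSubgroups.HasOrder-1⇒≈ε (AbelianGroup.group Q) b-order))
lemma3p6 p q pp pq p≢q P Q P-finite P-pgroup _ Q-pgroup a b (suc u) a≉ε b≉ε a∉M b-order b∈M x y =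
  mk⇔ InNbhdClass⇒Description Description⇒InNbhdClass
  where
  open ProductOfCoprimePGroups pp pq p≢q (AbelianGroup.group P) (AbelianGroup.group Q) P-pgroup Q-pgroup
  open NeighbourhoodClass P-finite a b u a≉ε b≉ε a∉M b-order b∈M
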